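{- For every finite graph $G$, $\mathcal{L}(G)\le 2c_0(G)$.
   Context: Lions and contamination: a lion strategy with $k\ge1$ lions on $G=(V,E)$ has initial positions $p_i(0)$ and $p_i(t)\in\{p_i(t-1)\}\cup N(p_i(t-1))$ for $t\ge1$ ($N(v)$ the neighbours of $v$); $L_t=\{p_i(t)\}_i$, $\pi_t=\{(p_i(t-1),p_i(t))\}_i$; $W_0=V\setminus L_0$, $W_t=(W_{t-1}\setminus L_t)\cup\{v\in V\setminus L_t:\exists w\in W_{t-1}\cap N(v),\ (v,w)\notin\pi_t,(w,v)\notin\pi_t\}$; it clears $G$ if $W_T=\emptyset$ for some $T$; $\mathcal{L}(G)$ is the minimum number of lions of a clearing strategy. Zero-visibility cops and robber: for $S\subseteq V$, $N(S)=\{w\in V\setminus S: w\text{ adjacent to some }v\in S\}$. With $k$ cops at initial positions $q_i(0)$, each cop at each turn $t\ge1$ stays or moves to an adjacent vertex; $P_t=\{q_i(t)\}_i$. Dirty sets: $R_0=V$, $S_t=R_t\setminus P_t$, $R_{t+1}=(N(S_t)\cup S_t)\setminus P_t$. The cops clear $G$ if $S_t=\emptyset$ for some $t$; $c_0(G)$ is the minimum number of cops that can clear $G$. -}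

module Defs where

open import Data.Nat using (ℕ; zero; suc)
open import Data.Fin using (Fin)
open import Data.Product using (Σ; ∃; ∃-syntax; _×_; _,_)
open import Data.Sum using (_⊎_)
open import Data.Unit using (⊤)
open import Data.Empty using (⊥)
open import Relation.Nullary using (¬_)
open import Relation.Binary using (Decidable)
open import Relation.Binary.PropositionalEquality using (_≡_)

record Graph (n : ℕ) : Set₁ where
  field
    E       : Fin n → Fin n → Set
    E-sym   : ∀ {u v} → E u v → E v u
    E-irrefl : ∀ {v} → ¬ E v v
    E?      : Decidable E

open Graph public

Pred : ℕ → Set₁
Pred n = Fin n → Set

record Walk {n : ℕ} (G : Graph n) (k : ℕ) : Set where
  field
    pos   : ℕ → Fin k → Fin n
    moves : ∀ t i → pos (suc t) i ≡ pos t i ⊎ E G (pos t i) (pos (suc t) i)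

open Walk public

Occ : ∀ {n k} {G : Graph n} → Walk G k → ℕ → Pred n
Occ w t v = ∃[ i ] pos w t i ≡ v

Moved : ∀ {n k} {G : Graph n} → Walk G k → ℕ → Fin n → Fin n → Set
Moved w t a b = ∃[ i ] (pos w t i ≡ a × pos w (suc t) i ≡ b)

Contam : ∀ {n k} {G : Graph n} → Walk G k → ℕ → Pred n
Contam w zero v = ¬ Occ w zero v
Contam {G = G} w (suc t) v =
  ¬ Occ w (suc t) v ×
  (Contam w t v ⊎
   ∃[ u ] (Contam w t u × E G v u × ¬ Moved w t v u × ¬ Moved w t u v))

LionsClear : ∀ {n} → Graph n → ℕ → Set
LionsClear G k = Σ (Walk G k) λ w → ∃[ T ] ∀ v → ¬ Contam w T v

Nbhd : ∀ {n} → Graph n → Pred n → Pred n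
Nbhd G S v = ¬ S v × ∃[ u ] (S u × E G u v)

mutual
  DirtyR : ∀ {n k} {G : Graph n} → Walk G k → ℕ → Pred n
  DirtyR w zero v = ⊤
  DirtyR {G = G} w (suc t) v = (Nbhd G (DirtyS w t) v ⊎ DirtyS w t v) × ¬ Occ w t v

  DirtyS : ∀ {n k} {G : Graph n} → Walk G k → ℕ → Pred n
  DirtyS w t v = DirtyR w t v × ¬ Occ w t v

CopsClear : ∀ {n} → Graph n → ℕ → Set
CopsClear G k = Σ (Walk G k) λ w → ∃[ T ] ∀ v → ¬ DirtyS w T v

-- Let k cops clear G in T rounds, and station 2k lions so that at time t they
-- occupy the cops' positions at times t and t + 1.  By induction on t, every
-- vertex contaminated for the lions at time t is (not not) dirty for the cops
-- at time t + 1: a lion-free vertex is cop-free at both times, so dirt both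
-- persists on it and spreads into it along any edge.  Since S_T = ∅ forces
-- S_{T+1} = ∅, no vertex is contaminated at time T.
module Submission where

open import Defs
open import Data.Nat using (ℕ; _*_; _+_; zero; suc)
open import Data.Nat.Properties using (+-identityʳ)
open import Data.Fin using (splitAt; _↑ˡ_; _↑ʳ_)
open import Data.Fin.Properties using (splitAt-↑ˡ; splitAt-↑ʳ)
open import Data.Sum using (inj₁; inj₂; [_,_]′)
open import Data.Product using (_×_; _,_)
open import Data.Unit using (tt)
open import Relation.Nullary.Negation using (¬_; ¬¬-map)
open import Relation.Binary.PropositionalEquality using (_≡_; refl; sym; cong; subst)

module _ {n : ℕ} {G : Graph n} where

  shift : ∀ {k} → Walk G k → Walk G k
  pos (shift w) t = pos w (suc t)
  moves (shift w) t = moves w (suc t)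

  _∥_ : ∀ {k m} → Walk G k → Walk G m → Walk G (k + m)
  pos (_∥_ {k} w₁ w₂) t i = [ pos w₁ t , pos w₂ t ]′ (splitAt k i)
  moves (_∥_ {k} w₁ w₂) t i with splitAt k i
  ... | inj₁ j = moves w₁ t j
  ... | inj₂ j = moves w₂ t j

  Occ-∥ˡ : ∀ {k m} (w₁ : Walk G k) (w₂ : Walk G m) {t v} → Occ w₁ t v → Occ (w₁ ∥ w₂) t v
  Occ-∥ˡ {k} {m} w₁ w₂ {t} (j , refl) = j ↑ˡ m , cong [ pos w₁ t , pos w₂ t ]′ (splitAt-↑ˡ k j m)

  Occ-∥ʳ : ∀ {k m} (w₁ : Walk G k) (w₂ : Walk G m) {t v} → Occ w₂ t v → Occ (w₁ ∥ w₂) t v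
  Occ-∥ʳ {k} {m} w₁ w₂ {t} (j , refl) = k ↑ʳ j , cong [ pos w₁ t , pos w₂ t ]′ (splitAt-↑ʳ k m j)

  Occ-subst : ∀ {k m} (eq : k ≡ m) (w : Walk G k) {t v} → Occ w t v → Occ (subst (Walk G) eq w) t v
  Occ-subst refl w occ = occ

  DirtyS-stays : ∀ {k} (w : Walk G k) {t v} → DirtyS w t v → ¬ Occ w (suc t) v → DirtyS w (suc t) v
  DirtyS-stays w s@(_ , v∉Pₜ) v∉Pₜ₊₁ = (inj₂ s , v∉Pₜ) , v∉Pₜ₊₁

  -- Without decidability of S_t we cannot tell whether v lies in N(S_t) or in S_t,
  -- hence the double negation.
  DirtyS-spreads : ∀ {k} (w : Walk G k) {t u v} → DirtyS w t u → E G u v →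
                   ¬ Occ w t v → ¬ Occ w (suc t) v → ¬ ¬ DirtyS w (suc t) v
  DirtyS-spreads w sᵤ e v∉Pₜ v∉Pₜ₊₁ ¬sᵥ =
    ¬sᵥ ((inj₁ ((λ s → ¬sᵥ (DirtyS-stays w s v∉Pₜ₊₁)) , _ , sᵤ , e) , v∉Pₜ) , v∉Pₜ₊₁)

  DirtyS-empty-suc : ∀ {k} (w : Walk G k) {t} → (∀ v → ¬ DirtyS w t v) → ∀ v → ¬ DirtyS w (suc t) v
  DirtyS-empty-suc w empty v ((inj₁ (_ , u , sᵤ , _) , _) , _) = empty u sᵤ
  DirtyS-empty-suc w empty v ((inj₂ sᵥ , _) , _) = empty v sᵥ

  module _ {k : ℕ} (w : Walk G k) where

    k+k≡2*k : k + k ≡ 2 * k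
    k+k≡2*k = cong (k +_) (sym (+-identityʳ k))

    lions : Walk G (2 * k)
    lions = subst (Walk G) k+k≡2*k (w ∥ shift w)

    lion-free⇒cop-free : ∀ {t v} → ¬ Occ lions t v → ¬ Occ w t v × ¬ Occ w (suc t) v
    lion-free⇒cop-free v∉L =
        (λ occ → v∉L (Occ-subst k+k≡2*k (w ∥ shift w) (Occ-∥ˡ w (shift w) occ)))
      , (λ occ → v∉L (Occ-subst k+k≡2*k (w ∥ shift w) (Occ-∥ʳ w (shift w) occ)))

    Contam⇒DirtyS-suc : ∀ t {v} → Contam lions t v → ¬ ¬ DirtyS w (suc t) v
    Contam⇒DirtyS-suc zero v∉L₀ ¬s
      with v∉P₀ , v∉P₁ ← lion-free⇒cop-free v∉L₀ = ¬s (DirtyS-stays w (tt , v∉P₀) v∉P₁)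
    Contam⇒DirtyS-suc (suc t) (v∉L , inj₁ cᵥ)
      with _ , v∉Pₜ₊₂ ← lion-free⇒cop-free v∉L =
      ¬¬-map (λ s → DirtyS-stays w s v∉Pₜ₊₂) (Contam⇒DirtyS-suc t cᵥ)
    Contam⇒DirtyS-suc (suc t) (v∉L , inj₂ (_ , cᵤ , e , _)) ¬sᵥ
      with v∉Pₜ₊₁ , v∉Pₜ₊₂ ← lion-free⇒cop-free v∉L =
      Contam⇒DirtyS-suc t cᵤ λ sᵤ → DirtyS-spreads w sᵤ (E-sym G e) v∉Pₜ₊₁ v∉Pₜ₊₂ ¬sᵥ

lemma27 : ∀ {n} (G : Graph n) (k : ℕ) → CopsClear G k → LionsClear G (2 * k)
lemma27 G k (w , T , S-empty) =
  lions w , T , λ v cᵥ → Contam⇒DirtyS-suc w T cᵥ (DirtyS-empty-suc w S-empty v)
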